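{- Let $(T,\mathcal{X})$ be a rooted tree-cut decomposition of a graph $G$. The procedure $\textsc{Top-down Rerouting}$, started on $(T,\mathcal{X})$, terminates after performing $\textsc{Rerouting}$ at most $2|V(T)|$ times.
   Context: All graphs are finite and simple; for $Y\subseteq V(G)$, $N(Y)$ denotes the set of vertices outside $Y$ adjacent to some vertex of $Y$. A tree-cut decomposition of $G$ is a pair $(T,\mathcal{X})$ where $T$ is a tree and $\mathcal{X}=\{X_t : t\in V(T)\}$ is a family of pairwise disjoint, possibly empty, subsets of $V(G)$ whose union is $V(G)$. For an edge $e=uv$ of $T$, $\mathsf{cut}(e)$ is the set of edges of $G$ with one endpoint in the union of bags of the component of $T-e$ containing $u$ and the other in the union of bags of the component containing $v$. In a rooted decomposition with root $r$: for $t\neq r$, $e(t)$ is the edge from $t$ to its parent and $\mathsf{adh}(t)=|\mathsf{cut}(e(t))|$; $Y_t$ is the union of bags of the subtree rooted at $t$; siblings are nodes with the same parent; the depth of a node is its distance from $r$. A node $t\neq r$ is bad if $\mathsf{adh}(t)\le 2$ and there is a sibling $b$ of $t$ with $N(Y_t)\cap Y_b\neq\emptyset$; the decomposition is nice if it has no bad node. For a bad node $t$, a node $b$ is a bad neighbour of $t$ if $N(Y_t)\cap X_b\neq\emptyset$ and $b$ is a sibling of $t$ or a descendant of a sibling of $t$. $\textsc{Rerouting}(t)$, for a bad node $t$: choose a bad neighbour $b$ of $t$ of maximum depth (ties broken arbitrarily), remove the tree edge $e(t)$ and add the tree edge $\{b,t\}$ (so $b$ becomes the parent of $t$). $\textsc{Top-down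 Rerouting}$: as long as the current decomposition is not nice, pick any bad node $t$ of minimum depth and perform $\textsc{Rerouting}(t)$. -}

module Defs where

open import Data.Nat using (ℕ; zero; suc; _≤_; _*_)
open import Data.Fin using (Fin; _≟_)
open import Data.Bool using (Bool; true; false; _∧_; _∨_; not; if_then_else_)
open import Data.List using (List; length; filterᵇ; allFin; cartesianProduct)
open import Data.Product using (Σ; ∃; _×_; _,_; proj₁; proj₂)
open import Relation.Nullary using (¬_)
open import Relation.Nullary.Decidable using (⌊_⌋)
open import Relation.Binary.PropositionalEquality using (_≡_; _≢_)

record Graph (n : ℕ) : Set where
  field
    adj    : Fin n → Fin n → Bool
    sym    : ∀ u v → adj u v ≡ adj v u
    irrefl : ∀ u → adj u u ≡ false
open Graph public

-- The tree T is given by a parent map (the root r, fixed separately,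
-- satisfies parent r ≡ r); the bags X_t = { v | bag v ≡ t } are pairwise
-- disjoint, possibly empty, and cover V(G).
record TCD (n m : ℕ) : Set where
  field
    parent : Fin m → Fin m
    bag    : Fin n → Fin m
open TCD public

iter : ∀ {A : Set} → (A → A) → ℕ → A → A
iter f zero    x = x
iter f (suc k) x = f (iter f k x)

IsRootedTree : ∀ {n m} → Fin m → TCD n m → Set
IsRootedTree r D = (parent D r ≡ r) × (∀ t → ∃ λ k → iter (parent D) k t ≡ r)

module _ {n m : ℕ} (G : Graph n) (r : Fin m) (D : TCD n m) where

  -- descendant test: d is a descendant of a (d = a allowed);
  -- in a tree on m nodes every ancestor is reached within m steps
  descAux : ℕ → Fin m → Fin m → Bool
  descAux zero    d a = ⌊ d ≟ a ⌋
  descAux (suc f) d a = ⌊ d ≟ a ⌋ ∨ descAux f (parent D d) a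

  desc : Fin m → Fin m → Bool
  desc d a = descAux m d a

  inY : Fin m → Fin n → Bool
  inY t v = desc (bag D v) t

  depthAux : ℕ → Fin m → ℕ
  depthAux zero    t = zero
  depthAux (suc f) t = if ⌊ t ≟ r ⌋ then zero else suc (depthAux f (parent D t))

  depth : Fin m → ℕ
  depth t = depthAux m t

  -- adh(t) = |cut(e(t))|: edges uv with u ∈ Y_t, v ∉ Y_t (each counted once)
  adh : Fin m → ℕ
  adh t = length (filterᵇ (λ p → adj G (proj₁ p) (proj₂ p) ∧ inY t (proj₁ p) ∧ not (inY t (proj₂ p)))
                          (cartesianProduct (allFin n) (allFin n)))

  NMeets : Fin m → (Fin n → Set) → Set
  NMeets t S = ∃ λ v → S v × (inY t v ≡ false) × (∃ λ u → (inY t u ≡ true) × (adj G u v ≡ true))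

  Sibling : Fin m → Fin m → Set
  Sibling t b = (b ≢ t) × (t ≢ r) × (b ≢ r) × (parent D b ≡ parent D t)

  Bad : Fin m → Set
  Bad t = (t ≢ r) × (adh t ≤ 2) × (∃ λ b → Sibling t b × NMeets t (λ v → inY b v ≡ true))

  Nice : Set
  Nice = ∀ t → ¬ Bad t

  BadNeighbour : Fin m → Fin m → Set
  BadNeighbour t b = NMeets t (λ v → bag D v ≡ b) × (∃ λ s → Sibling t s × (desc b s ≡ true))

  TopDownChoice : Fin m → Fin m → Set
  TopDownChoice t b =
    Bad t × (∀ t' → Bad t' → depth t ≤ depth t') ×
    BadNeighbour t b × (∀ b' → BadNeighbour t b' → depth b' ≤ depth b)

reroute : ∀ {n m} → TCD n m → Fin m → Fin m → TCD n m
reroute D t b = record { parent = λ x → if ⌊ x ≟ t ⌋ then b else parent D x ; bag = bag D }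

data Run {n m : ℕ} (G : Graph n) (r : Fin m) : TCD n m → ℕ → TCD n m → Set where
  done : ∀ {D} → Run G r D zero D
  step : ∀ {D D' k} (t b : Fin m) → TopDownChoice G r D t b →
         Run G r (reroute D t b) k D' → Run G r D (suc k) D'

-- Rerouting a bad node t to a bad neighbour b only enlarges the ancestor
-- relation of the tree: b lies below a sibling of t, so every old ancestor of t
-- is still an ancestor of b.  Call a cut edge of e(a) upward if its outer end
-- lies in the bag of an ancestor of a.  Since ancestors only accumulate, the
-- number of upward cut edges of a node never decreases.  At t the edge from Y_t
-- into X_b is not upward before the step but is afterwards, and before the step
-- t had at most adh(t) - 1 ≤ 1 upward edges.  So the potential
-- Σ_a min(2, #upward cut edges of a) ≤ 2|V(T)| grows with every rerouting.
{-# OPTIONS --safe #-}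
module Submission where

open import Defs hiding (sym)
open import Data.Nat using (ℕ; zero; suc; _+_; _*_; _∸_; _⊓_; _≤_; _<_; z≤n; s≤s; _≤?_)
open import Data.Nat.Properties hiding (_≟_)
open import Data.Nat.Induction using (<-rec)
open import Data.Nat.ListAction using (sum)
open import Data.Fin using (Fin; _≟_; toℕ)
open import Data.Fin.Properties using (pigeonhole; toℕ≤pred[n])
open import Data.Bool using (Bool; true; false; _∧_; _∨_; not)
open import Data.Bool.Properties using (∨-zeroʳ; ∧-zeroʳ; ¬-not; not-injective)
open import Data.List using (List; []; _∷_; map; length; filterᵇ; allFin; cartesianProduct)
open import Data.List.Properties using (length-tabulate)
open import Data.List.Membership.Propositional using (_∈_)
open import Data.List.Membership.Propositional.Properties using (∈-allFin; ∈-cartesianProduct⁺)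
open import Data.List.Relation.Unary.Any using (here; there)
open import Data.Product using (∃; _×_; _,_; proj₁; proj₂)
open import Data.Sum using (_⊎_; inj₁; inj₂)
open import Function using (_∘_)
open import Relation.Nullary using (¬_; yes; no; contradiction)
open import Relation.Nullary.Decidable using (⌊_⌋)
open import Relation.Binary.PropositionalEquality

module _ {A : Set} (f : A → A) where

  iter-suc : ∀ k x → iter f (suc k) x ≡ iter f k (f x)
  iter-suc zero    x = refl
  iter-suc (suc k) x = cong f (iter-suc k x)

  iter-+ : ∀ i j x → iter f (i + j) x ≡ iter f i (iter f j x)
  iter-+ zero    j x = refl
  iter-+ (suc i) j x = cong f (iter-+ i j x)

  iter-split : ∀ {i j} x → i ≤ j → iter f j x ≡ iter f (j ∸ i) (iter f i x)
  iter-split {i} {j} x i≤j =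
    trans (cong (λ k → iter f k x) (sym (m∸n+n≡m i≤j))) (iter-+ (j ∸ i) i x)

  iter-fixed : ∀ k {x} → f x ≡ x → iter f k x ≡ x
  iter-fixed zero    fx≡x = refl
  iter-fixed (suc k) fx≡x = trans (cong f (iter-fixed k fx≡x)) fx≡x

  iter-periodic : ∀ p {x} → iter f p x ≡ x → ∀ n → iter f (n * p) x ≡ x
  iter-periodic p period zero    = refl
  iter-periodic p {x} period (suc n) =
    trans (iter-+ p (n * p) x) (trans (cong (iter f p) (iter-periodic p period n)) period)

  Desc : A → A → Set
  Desc d a = ∃ λ k → iter f k d ≡ a

  Desc-trans : ∀ {d a a′} → Desc d a → Desc a a′ → Desc d a′
  Desc-trans {d} (i , refl) (j , refl) = j + i , iter-+ j i d

  Desc-parent : ∀ {d a} → Desc (f d) a → Desc d a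
  Desc-parent {d} (k , p) = suc k , trans (iter-suc k d) p

  Desc-comparable : ∀ {d a a′} → Desc d a → Desc d a′ → Desc a a′ ⊎ Desc a′ a
  Desc-comparable {d} (i , refl) (j , refl) with ≤-total i j
  ... | inj₁ i≤j = inj₁ (j ∸ i , sym (iter-split d i≤j))
  ... | inj₂ j≤i = inj₂ (i ∸ j , sym (iter-split d j≤i))

  module RootedTree (r : A) (root-fixed : f r ≡ r) (reaches-root : ∀ x → Desc x r) where

    on-cycle⇒root : ∀ q {x} → iter f (suc q) x ≡ x → x ≡ r
    on-cycle⇒root q {x} cycle with reaches-root x
    ... | K , x↝r = begin
      x                                   ≡⟨ sym (iter-periodic (suc q) cycle K) ⟩
      iter f (K * suc q) x                ≡⟨ iter-split x (m≤m*n K (suc q)) ⟩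
      iter f (K * suc q ∸ K) (iter f K x) ≡⟨ cong (iter f (K * suc q ∸ K)) x↝r ⟩
      iter f (K * suc q ∸ K) r            ≡⟨ iter-fixed (K * suc q ∸ K) root-fixed ⟩
      r                                   ∎
      where open ≡-Reasoning

    Desc-antisym : ∀ {x y} → Desc x y → Desc y x → x ≡ y
    Desc-antisym (zero , x≡y) _ = x≡y
    Desc-antisym {x} {y} (suc i , x↝y) (j , y↝x) = trans x≡r (sym y≡r)
      where
        open ≡-Reasoning
        x≡r : x ≡ r
        x≡r = on-cycle⇒root (j + i) (begin
          iter f (suc (j + i)) x       ≡⟨ cong (λ k → iter f k x) (sym (+-suc j i)) ⟩
          iter f (j + suc i) x         ≡⟨ iter-+ j (suc i) x ⟩
          iter f j (iter f (suc i) x)  ≡⟨ cong (iter f j) x↝y ⟩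
          iter f j y                   ≡⟨ y↝x ⟩
          x                            ∎)
        y≡r : y ≡ r
        y≡r = begin
          y                  ≡⟨ sym x↝y ⟩
          iter f (suc i) x   ≡⟨ cong (iter f (suc i)) x≡r ⟩
          iter f (suc i) r   ≡⟨ iter-fixed (suc i) root-fixed ⟩
          r                  ∎

    sibling-¬Desc : ∀ {x y} → x ≢ y → y ≢ r → f x ≡ f y → ¬ Desc x y
    sibling-¬Desc x≢y y≢r fx≡fy (zero , x≡y) = x≢y x≡y
    sibling-¬Desc {x} {y} x≢y y≢r fx≡fy (suc k , x↝y) =
      y≢r (on-cycle⇒root 0 (sym (Desc-antisym (1 , refl) fy↝y)))
      where
        fy↝y : Desc (f y) y
        fy↝y = k , trans (cong (iter f k) (sym fx≡fy)) (trans (sym (iter-suc k x)) x↝y)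

module _ {m : ℕ} (f : Fin m → Fin m) {x a : Fin m} where

  iter-shortcut : ∀ {i j k} → iter f i x ≡ iter f j x → j ≤ k →
                  iter f (k ∸ j + i) x ≡ iter f k x
  iter-shortcut {i} {j} {k} fⁱx≡fʲx j≤k = begin
    iter f (k ∸ j + i) x         ≡⟨ iter-+ f (k ∸ j) i x ⟩
    iter f (k ∸ j) (iter f i x)  ≡⟨ cong (iter f (k ∸ j)) fⁱx≡fʲx ⟩
    iter f (k ∸ j) (iter f j x)  ≡⟨ sym (iter-split f x j≤k) ⟩
    iter f k x                   ∎
    where open ≡-Reasoning

  -- By pigeonhole, any path of more than m steps revisits a node and can be shortened.
  Desc-within-bound : Desc f x a → ∃ λ k → k ≤ m × iter f k x ≡ a
  Desc-within-bound (k , x↝a) = <-rec Goal shorten k x↝a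
    where
      Goal : ℕ → Set
      Goal k = iter f k x ≡ a → ∃ λ k′ → k′ ≤ m × iter f k′ x ≡ a

      shorten : ∀ k → (∀ {j} → j < k → Goal j) → Goal k
      shorten k rec x↝a with k ≤? m
      ... | yes k≤m = k , k≤m , x↝a
      ... | no k≰m with pigeonhole (n<1+n m) (λ i → iter f (toℕ i) x)
      ... | i , j , i<j , same = rec shorter (trans (iter-shortcut same j≤k) x↝a)
        where
          j≤k : toℕ j ≤ k
          j≤k = ≤-trans (toℕ≤pred[n] j) (<⇒≤ (≰⇒> k≰m))
          shorter : k ∸ toℕ j + toℕ i < k
          shorter = <-≤-trans (+-monoʳ-< (k ∸ toℕ j) i<j) (≤-reflexive (m∸n+n≡m j≤k))

⌊≟⌋-refl : ∀ {m} (d : Fin m) → ⌊ d ≟ d ⌋ ≡ true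
⌊≟⌋-refl d with d ≟ d
... | yes _  = refl
... | no d≢d = contradiction refl d≢d

module _ {n m : ℕ} (G : Graph n) (r : Fin m) (D : TCD n m) where

  descAux-refl : ∀ fuel d → descAux G r D fuel d d ≡ true
  descAux-refl zero       d = ⌊≟⌋-refl d
  descAux-refl (suc fuel) d = cong (_∨ descAux G r D fuel (parent D d) d) (⌊≟⌋-refl d)

  descAux-complete : ∀ {fuel} k {d a} → k ≤ fuel → iter (parent D) k d ≡ a →
                     descAux G r D fuel d a ≡ true
  descAux-complete {fuel} zero _ refl = descAux-refl fuel _
  descAux-complete {suc fuel} (suc k) {d} {a} (s≤s k≤fuel) d↝a =
    trans (cong (⌊ d ≟ a ⌋ ∨_) (descAux-complete k k≤fuel (trans (sym (iter-suc (parent D) k d)) d↝a)))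
          (∨-zeroʳ ⌊ d ≟ a ⌋)

  descAux-sound : ∀ fuel {d a} → descAux G r D fuel d a ≡ true → Desc (parent D) d a
  descAux-sound zero {d} {a} e with d ≟ a
  ... | yes d≡a = 0 , d≡a
  descAux-sound zero () | no _
  descAux-sound (suc fuel) {d} {a} e with d ≟ a
  ... | yes d≡a = 0 , d≡a
  ... | no _    = Desc-parent (parent D) (descAux-sound fuel e)

  desc-sound : ∀ {d a} → desc G r D d a ≡ true → Desc (parent D) d a
  desc-sound = descAux-sound m

  desc-complete : ∀ {d a} → Desc (parent D) d a → desc G r D d a ≡ true
  desc-complete d↝a with Desc-within-bound (parent D) d↝a
  ... | k , k≤m , d↝a′ = descAux-complete k k≤m d↝a′

module _ {n m : ℕ} (D : TCD n m) (t b : Fin m) where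

  private
    P P′ : Fin m → Fin m
    P  = parent D
    P′ = parent (reroute D t b)

  reroute-parent-self : P′ t ≡ b
  reroute-parent-self rewrite ⌊≟⌋-refl t = refl

  reroute-parent-other : ∀ {x} → x ≢ t → P′ x ≡ P x
  reroute-parent-other {x} x≢t with x ≟ t
  ... | yes x≡t = contradiction x≡t x≢t
  ... | no _    = refl

  reroute-path-avoiding : ∀ {y} → ¬ Desc P y t → ∀ i → iter P′ i y ≡ iter P i y
  reroute-path-avoiding y↛t zero    = refl
  reroute-path-avoiding y↛t (suc i) rewrite reroute-path-avoiding y↛t i =
    reroute-parent-other (λ fⁱy≡t → y↛t (i , fⁱy≡t))

  reroute-extends-Desc : ¬ Desc P b t → Desc P b (P t) →
                         ∀ {x a} → Desc P x a → Desc P′ x a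
  reroute-extends-Desc b↛t b↝Pt (k , x↝a) = go k x↝a
    where
      go : ∀ k {x a} → iter P k x ≡ a → Desc P′ x a
      go zero    x↝a = 0 , x↝a
      go (suc k) {x} {a} x↝a with x ≟ t
      ... | yes refl with Desc-trans P b↝Pt (k , trans (sym (iter-suc P k x)) x↝a)
      ...   | j , b↝a = suc j , (begin
        iter P′ (suc j) x   ≡⟨ iter-suc P′ j x ⟩
        iter P′ j (P′ x)    ≡⟨ cong (iter P′ j) reroute-parent-self ⟩
        iter P′ j b         ≡⟨ reroute-path-avoiding b↛t j ⟩
        iter P j b          ≡⟨ b↝a ⟩
        a                   ∎)
        where open ≡-Reasoning
      go (suc k) {x} {a} x↝a | no x≢t =
        Desc-parent P′ (subst (λ z → Desc P′ z a) (sym (reroute-parent-other x≢t))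
                              (go k (trans (sym (iter-suc P k x)) x↝a)))

module _ {A : Set} where

  length-filterᵇ-mono : (f g : A → Bool) → (∀ x → f x ≡ true → g x ≡ true) →
                        ∀ xs → length (filterᵇ f xs) ≤ length (filterᵇ g xs)
  length-filterᵇ-mono f g f⇒g []       = z≤n
  length-filterᵇ-mono f g f⇒g (x ∷ xs) with f x in fx | g x in gx
  ... | true  | true  = s≤s (length-filterᵇ-mono f g f⇒g xs)
  ... | true  | false = contradiction (trans (sym (f⇒g x fx)) gx) λ ()
  ... | false | true  = m≤n⇒m≤1+n (length-filterᵇ-mono f g f⇒g xs)
  ... | false | false = length-filterᵇ-mono f g f⇒g xs

  length-filterᵇ-mono-< : (f g : A → Bool) → (∀ x → f x ≡ true → g x ≡ true) →
                          ∀ {x₀} xs → x₀ ∈ xs → f x₀ ≡ false → g x₀ ≡ true →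
                          length (filterᵇ f xs) < length (filterᵇ g xs)
  length-filterᵇ-mono-< f g f⇒g (x ∷ xs) (here refl) fx gx rewrite fx | gx =
    s≤s (length-filterᵇ-mono f g f⇒g xs)
  length-filterᵇ-mono-< f g f⇒g (x ∷ xs) (there x₀∈xs) fx₀ gx₀ with f x in fx | g x in gx
  ... | true  | true  = s≤s (length-filterᵇ-mono-< f g f⇒g xs x₀∈xs fx₀ gx₀)
  ... | true  | false = contradiction (trans (sym (f⇒g x fx)) gx) λ ()
  ... | false | true  = m≤n⇒m≤1+n (length-filterᵇ-mono-< f g f⇒g xs x₀∈xs fx₀ gx₀)
  ... | false | false = length-filterᵇ-mono-< f g f⇒g xs x₀∈xs fx₀ gx₀

  sum-map-mono-≤ : (f g : A → ℕ) → (∀ x → f x ≤ g x) →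
                   ∀ xs → sum (map f xs) ≤ sum (map g xs)
  sum-map-mono-≤ f g f≤g []       = z≤n
  sum-map-mono-≤ f g f≤g (x ∷ xs) = +-mono-≤ (f≤g x) (sum-map-mono-≤ f g f≤g xs)

  sum-map-mono-< : (f g : A → ℕ) → (∀ x → f x ≤ g x) →
                   ∀ {x₀} xs → x₀ ∈ xs → f x₀ < g x₀ → sum (map f xs) < sum (map g xs)
  sum-map-mono-< f g f≤g (x ∷ xs) (here refl)   fx<gx = +-mono-<-≤ fx<gx (sum-map-mono-≤ f g f≤g xs)
  sum-map-mono-< f g f≤g (x ∷ xs) (there x₀∈xs) fx<gx = +-mono-≤-< (f≤g x) (sum-map-mono-< f g f≤g xs x₀∈xs fx<gx)

  sum-map-≤-*-length : (f : A → ℕ) {c : ℕ} → (∀ x → f x ≤ c) →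
                       ∀ xs → sum (map f xs) ≤ c * length xs
  sum-map-≤-*-length f {c} f≤c []       = z≤n
  sum-map-≤-*-length f {c} f≤c (x ∷ xs) =
    ≤-trans (+-mono-≤ (f≤c x) (sum-map-≤-*-length f f≤c xs)) (≤-reflexive (sym (*-suc c (length xs))))

⊓-monoʳ-<-below : ∀ c {x y} → x < c → x < y → c ⊓ x < c ⊓ y
⊓-monoʳ-<-below c x<c x<y rewrite m≥n⇒m⊓n≡n (<⇒≤ x<c) = ⊓-glb x<c x<y

∧-true⁺ : ∀ {x y} → x ≡ true → y ≡ true → x ∧ y ≡ true
∧-true⁺ refl refl = refl

∧-true⁻ : ∀ {x y} → x ∧ y ≡ true → x ≡ true × y ≡ true
∧-true⁻ {true} {true} refl = refl , refl

module Potential {n m : ℕ} (G : Graph n) (r : Fin m) where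

  vertexPairs : List (Fin n × Fin n)
  vertexPairs = cartesianProduct (allFin n) (allFin n)

  -- definitionally the predicate filtered in adh
  crosses : TCD n m → Fin m → Fin n × Fin n → Bool
  crosses D a (u , w) = adj G u w ∧ inY G r D a u ∧ not (inY G r D a w)

  upward : TCD n m → Fin m → Fin n × Fin n → Bool
  upward D a (u , w) = crosses D a (u , w) ∧ desc G r D a (bag D w)

  upwardCount : TCD n m → Fin m → ℕ
  upwardCount D a = length (filterᵇ (upward D a) vertexPairs)

  potential : TCD n m → ℕ
  potential D = sum (map (λ a → 2 ⊓ upwardCount D a) (allFin m))

  potential≤2m : ∀ D → potential D ≤ 2 * m
  potential≤2m D = ≤-trans (sum-map-≤-*-length _ (λ a → m⊓n≤m 2 (upwardCount D a)) (allFin m))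
                           (≤-reflexive (cong (2 *_) (length-tabulate {n = m} (λ a → a))))

  upwardCount<adh : ∀ D a {u w} → upward D a (u , w) ≡ false → crosses D a (u , w) ≡ true →
                    upwardCount D a < adh G r D a
  upwardCount<adh D a {u} {w} =
    length-filterᵇ-mono-< (upward D a) (crosses D a) (λ p up → proj₁ (∧-true⁻ up)) vertexPairs
      (∈-cartesianProduct⁺ (∈-allFin u) (∈-allFin w))

  module AncestorExtension (D : TCD n m) (t b : Fin m) (rooted′ : IsRootedTree r (reroute D t b))
    (extends : ∀ {x a} → Desc (parent D) x a → Desc (parent (reroute D t b)) x a) where

    private
      D′ : TCD n m
      D′ = reroute D t b
      open RootedTree (parent D′) r (proj₁ rooted′) (proj₂ rooted′) using (Desc-antisym)

    desc-extends : ∀ {x a} → desc G r D x a ≡ true → desc G r D′ x a ≡ true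
    desc-extends = desc-complete G r D′ ∘ extends ∘ desc-sound G r D

    -- The outer end stays outside Y_a: its bag is a strict ancestor of a in D′.
    crosses⇒upward : ∀ a {u w} → crosses D a (u , w) ≡ true → Desc (parent D′) a (bag D w) →
                     upward D′ a (u , w) ≡ true
    crosses⇒upward a {u} {w} cross a↝w with ∧-true⁻ {adj G u w} cross
    ... | uw , inside with ∧-true⁻ {inY G r D a u} inside
    ...   | u∈ , w∉ = ∧-true⁺ (∧-true⁺ {adj G u w} uw (∧-true⁺ (desc-extends u∈) (cong not w∉′)))
                               (desc-complete G r D′ a↝w)
      where
        bag-w≢a : bag D w ≢ a
        bag-w≢a bag-w≡a = contradiction (trans (sym (desc-complete G r D (0 , bag-w≡a))) (not-injective w∉)) λ ()
        w∉′ : inY G r D′ a w ≡ false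
        w∉′ = ¬-not λ w∈′ → bag-w≢a (Desc-antisym (desc-sound G r D′ w∈′) a↝w)

    upward-mono : ∀ a p → upward D a p ≡ true → upward D′ a p ≡ true
    upward-mono a (u , w) up with ∧-true⁻ up
    ... | cross , a↝w = crosses⇒upward a cross (extends (desc-sound G r D a↝w))

    upwardCount-mono : ∀ a → upwardCount D a ≤ upwardCount D′ a
    upwardCount-mono a = length-filterᵇ-mono (upward D a) (upward D′ a) (upward-mono a) vertexPairs

  module BelowSibling (D : TCD n m) (rooted : IsRootedTree r D) {t b s : Fin m}
    (s≢t : s ≢ t) (t≢r : t ≢ r) (s≢r : s ≢ r) (Ps≡Pt : parent D s ≡ parent D t)
    (b↝s : Desc (parent D) b s) where

    private
      P : Fin m → Fin m
      P = parent D
      D′ : TCD n m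
      D′ = reroute D t b
      open RootedTree P r (proj₁ rooted) (proj₂ rooted) using (sibling-¬Desc)

    b↛t : ¬ Desc P b t
    b↛t b↝t with Desc-comparable P b↝t b↝s
    ... | inj₁ t↝s = sibling-¬Desc (s≢t ∘ sym) s≢r (sym Ps≡Pt) t↝s
    ... | inj₂ s↝t = sibling-¬Desc s≢t t≢r Ps≡Pt s↝t

    t↛b : ¬ Desc P t b
    t↛b t↝b = sibling-¬Desc (s≢t ∘ sym) s≢r (sym Ps≡Pt) (Desc-trans P t↝b b↝s)

    extends : ∀ {x a} → Desc P x a → Desc (parent D′) x a
    extends = reroute-extends-Desc D t b b↛t (Desc-trans P b↝s (1 , Ps≡Pt))

    rooted′ : IsRootedTree r D′
    rooted′ = trans (reroute-parent-other D t b (t≢r ∘ sym)) (proj₁ rooted) , extends ∘ proj₂ rooted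

    open AncestorExtension D t b rooted′ extends

    -- The edge uw of cut(e(t)) becomes upward: b = bag w is the new parent of t.
    potential-increases : ∀ {u w} → bag D w ≡ b → crosses D t (u , w) ≡ true → adh G r D t ≤ 2 →
                          potential D < potential D′
    potential-increases {u} {w} bag-w≡b cross adh≤2 =
      sum-map-mono-< (λ a → 2 ⊓ upwardCount D a) (λ a → 2 ⊓ upwardCount D′ a)
        (λ a → ⊓-monoʳ-≤ 2 (upwardCount-mono a)) (allFin m) (∈-allFin t)
        (⊓-monoʳ-<-below 2 (<-≤-trans (upwardCount<adh D t not-upward cross) adh≤2) count<)
      where
        not-upward : upward D t (u , w) ≡ false
        not-upward = trans (cong (crosses D t (u , w) ∧_)
                                 (¬-not λ t↝w → t↛b (subst (Desc P t) bag-w≡b (desc-sound G r D t↝w))))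
                           (∧-zeroʳ _)
        count< : upwardCount D t < upwardCount D′ t
        count< = length-filterᵇ-mono-< (upward D t) (upward D′ t) (upward-mono t) vertexPairs
                   (∈-cartesianProduct⁺ (∈-allFin u) (∈-allFin w)) not-upward
                   (crosses⇒upward t cross (1 , trans (reroute-parent-self D t b) (sym bag-w≡b)))

  reroute-bad : ∀ {D t b} → IsRootedTree r D → adh G r D t ≤ 2 → BadNeighbour G r D t b →
                IsRootedTree r (reroute D t b) × potential D < potential (reroute D t b)
  reroute-bad {D} rooted adh≤2
    ((w , bag-w≡b , w∉ , u , u∈ , uw) , s , (s≢t , t≢r , s≢r , Ps≡Pt) , b-desc-s) =
    rooted′ , potential-increases bag-w≡b (∧-true⁺ uw (∧-true⁺ u∈ (cong not w∉))) adh≤2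
    where open BelowSibling D rooted s≢t t≢r s≢r Ps≡Pt (desc-sound G r D b-desc-s)

  potential-run : ∀ {D k D′} → IsRootedTree r D → Run G r D k D′ → k + potential D ≤ potential D′
  potential-run rooted done = ≤-refl
  potential-run {D} {suc k} rooted (step t b ((_ , adh≤2 , _) , _ , bn , _) run)
    with reroute-bad rooted adh≤2 bn
  ... | rooted′ , increase = begin
    suc k + potential D                 ≡⟨ +-suc k (potential D) ⟨
    k + suc (potential D)               ≤⟨ +-monoʳ-≤ k increase ⟩
    k + potential (reroute D t b)       ≤⟨ potential-run rooted′ run ⟩
    _                                   ∎
    where open ≤-Reasoning

open Potential using (potential; potential≤2m; potential-run)

lemma3p3 : ∀ {n m : ℕ} (G : Graph n) (r : Fin m) (D₀ : TCD n m) →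
    IsRootedTree r D₀ →
    ∀ {k : ℕ} {D : TCD n m} → Run G r D₀ k D → k ≤ 2 * m
lemma3p3 {m = m} G r D₀ rooted {k} {D} run = begin
  k                        ≤⟨ m≤m+n k (potential G r D₀) ⟩
  k + potential G r D₀     ≤⟨ potential-run G r rooted run ⟩
  potential G r D          ≤⟨ potential≤2m G r D ⟩
  2 * m                    ∎
  where open ≤-Reasoning
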